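{- For every nonnegative integer $n$, the total number of missing integers, summed over all partitions of $n$, equals the total number of parts different from $1$ (counted with multiplicity) in all the partitions of $n$.
   Context: For a partition $\pi$ with largest part $L$, a missing integer of $\pi$ is a positive integer less than $L$ that does not occur as a part of $\pi$. -}

module Defs where

open import Data.Nat using (ℕ; zero; suc; _+_; _≤_; _<_; _≟_; _≤?_)
open import Data.List using (List; []; _∷_; map; filter; length; upTo)
open import Data.Nat.ListAction using (sum)
open import Relation.Binary.PropositionalEquality using (_≡_)
open import Data.List.Relation.Unary.All using (All)
open import Data.List.Relation.Unary.Linked using (Linked)
open import Data.List.Membership.DecPropositional _≟_ using (_∈?_; _∉_)
open import Relation.Nullary using (¬_)
open import Relation.Nullary.Decidable using (¬?)
open import Data.Product using (_×_)

IsPartition : ℕ → List ℕ → Set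
IsPartition n π = All (λ a → 1 ≤ a) π × Linked (λ a b → b ≤ a) π × sum π ≡ n

largest : List ℕ → ℕ
largest [] = 0
largest (a ∷ _) = a

missing : List ℕ → List ℕ
missing π = filter (λ k → ¬? (k ∈? π)) (filter (λ k → 1 ≤? k) (upTo (largest π)))

numMissing : List ℕ → ℕ
numMissing π = length (missing π)

numNonOneParts : List ℕ → ℕ
numNonOneParts π = length (filter (λ a → ¬? (a ≟ 1)) π)

-- The missing integers and the distinct parts of a partition π together make
-- up 1, …, largest π, while its parts equal to 1 and its other parts make up its
-- length. Conjugation exchanges largest part and length, so over all partitions
-- of n the total of the largest parts equals the total of the lengths. Trading a
-- part k for k parts equal to 1 matches the partitions having a part k with those
-- having at least k ones; counting the pairs (π, k) both ways, the total number of
-- distinct parts therefore equals the total number of ones. Subtracting these two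
-- equalities gives the theorem.
module Submission where

open import Defs
open import Level using (Level)
open import Function using (_∘_; id)
open import Function.Bundles using (_⇔_; Equivalence)
open import Data.Nat
  using (ℕ; zero; suc; _+_; _*_; _∸_; _≤_; _≥_; _<_; z≤n; s≤s; s≤s⁻¹)
open import Data.Nat.Properties
open import Algebra.Properties.CommutativeSemigroup +-commutativeSemigroup
  using (interchange; x∙yz≈y∙xz)
open import Data.Nat.ListAction using (sum)
open import Data.Nat.ListAction.Properties using (sum-++; sum-↭)
open import Data.List
  using (List; []; _∷_; [_]; _++_; map; filter; length; replicate; upTo)
open import Data.List.Properties
  using (length-++; length-map; length-replicate; length-filter; length-upTo; filter-++; filter-accept; filter-reject;
         filter-all; upTo-∷ʳ; map-upTo; map-cong; map-cong-local)
open import Data.List.Membership.Propositional using (_∈_)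
open import Data.List.Membership.Propositional.Properties using (∈-filter⁺; ∈-filter⁻; ∈-∃++)
open import Data.List.Membership.DecPropositional _≟_ using (_∈?_)
open import Data.List.Relation.Unary.All as All using (All; []; _∷_)
open import Data.List.Relation.Unary.All.Properties as All
  using (applyUpTo⁺₁; applyUpTo⁺₂)
open import Data.List.Relation.Unary.AllPairs using (_∷_)
open import Data.List.Relation.Unary.Any as Any using (Any; here; there)
open import Data.List.Relation.Unary.Linked as Linked using (Linked; []; [-]; _∷_)
open import Data.List.Relation.Unary.Unique.Propositional using (Unique)
import Data.List.Relation.Unary.Unique.Propositional.Properties as Unique
open import Data.List.Relation.Binary.Permutation.Propositional
  using (_↭_; ↭-refl; ↭-sym; ↭-trans; ↭-prep; ↭-swap; ↭⇒↭ₛ; module PermutationReasoning)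
open import Data.List.Relation.Binary.Permutation.Propositional.Properties
  using (All-resp-↭; ∈-resp-↭; map⁺; shift; drop-∷; ++⁺ˡ; ↭-length; filter-↭)
open import Data.List.Relation.Binary.Pointwise using (Pointwise-≡⇒≡)
open import Data.List.Relation.Unary.Sorted.TotalOrder.Properties using (↗↭↗⇒≋)
open import Relation.Binary.Properties.TotalOrder ≤-totalOrder using (≥-totalOrder)
open import Relation.Binary.Properties.DecTotalOrder ≤-decTotalOrder using (≥-decTotalOrder)
open import Data.List.Sort ≥-decTotalOrder using (sort; sort-↭; sort-↗)
open import Data.Product using (_×_; _,_; proj₁; proj₂)
open import Data.Sum using (inj₁; inj₂)
open import Relation.Binary.PropositionalEquality hiding ([_])
open import Relation.Nullary using (Dec; yes; no; ¬_; contradiction)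
open import Relation.Unary using (Pred; Decidable)
open import Relation.Unary.Properties using (∁?)

private
  variable
    a b p q r : Level
    A : Set a
    B : Set b

-- Counting and weighted sums

count : {P : Pred A p} → Decidable P → List A → ℕ
count P? xs = length (filter P? xs)

module _ {P : Pred A p} (P? : Decidable P) where

  count-++ : ∀ xs ys → count P? (xs ++ ys) ≡ count P? xs + count P? ys
  count-++ xs ys = trans (cong length (filter-++ P? xs ys)) (length-++ (filter P? xs))

  count-∁ : ∀ xs → count (∁? P?) xs + count P? xs ≡ length xs
  count-∁ [] = refl
  count-∁ (x ∷ xs) with P? x
  ... | yes _ = trans (+-suc _ _) (cong suc (count-∁ xs))
  ... | no _ = cong suc (count-∁ xs)

  count-map : ∀ (f : B → A) xs → count P? (map f xs) ≡ count (P? ∘ f) xs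
  count-map f [] = refl
  count-map f (x ∷ xs) with P? (f x)
  ... | yes _ = cong suc (count-map f xs)
  ... | no _ = count-map f xs

  count-↭ : ∀ {xs ys} → xs ↭ ys → count P? xs ≡ count P? ys
  count-↭ xs↭ys = ↭-length (filter-↭ P? xs↭ys)

  0<count⇒Any : ∀ xs → 0 < count P? xs → Any P xs
  0<count⇒Any [] ()
  0<count⇒Any (x ∷ xs) 0<c with P? x
  ... | yes px = here px
  ... | no _ = there (0<count⇒Any xs 0<c)

module _ {P : Pred ℕ p} (P? : Decidable P) where

  count-upTo-suc : ∀ m → count P? (upTo (suc m)) ≡ count P? (upTo m) + count P? [ m ]
  count-upTo-suc m = trans (cong (count P?) (sym (upTo-∷ʳ m))) (count-++ P? (upTo m) [ m ])

  count-upTo-suc-accept : ∀ {m} → P m → count P? (upTo (suc m)) ≡ suc (count P? (upTo m))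
  count-upTo-suc-accept {m} Pm =
    trans (count-upTo-suc m) (trans (cong (count P? (upTo m) +_) (cong length (filter-accept P? Pm)))
                                    (+-comm _ 1))

  count-upTo-beyond : ∀ {m n} → m ≤ n → (∀ {k} → m ≤ k → ¬ P k) →
                      count P? (upTo n) ≡ count P? (upTo m)
  count-upTo-beyond {n = zero} z≤n _ = refl
  count-upTo-beyond {m} {suc n} m≤1+n ¬P with m≤n⇒m<n∨m≡n m≤1+n
  ... | inj₂ refl = refl
  ... | inj₁ (s≤s m≤n) = begin
    count P? (upTo (suc n))              ≡⟨ count-upTo-suc n ⟩
    count P? (upTo n) + count P? [ n ]   ≡⟨ cong (count P? (upTo n) +_) (cong length (filter-reject P? (¬P m≤n))) ⟩
    count P? (upTo n) + 0                ≡⟨ +-identityʳ _ ⟩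
    count P? (upTo n)                    ≡⟨ count-upTo-beyond m≤n ¬P ⟩
    count P? (upTo m)                    ∎
    where open ≡-Reasoning

count-<-upTo : ∀ {c n} → c ≤ n → count (_<? c) (upTo n) ≡ c
count-<-upTo {c} {n} c≤n = begin
  count (_<? c) (upTo n)   ≡⟨ count-upTo-beyond (_<? c) c≤n (λ c≤k k<c → <⇒≱ k<c c≤k) ⟩
  count (_<? c) (upTo c)   ≡⟨ cong length (filter-all (_<? c) (applyUpTo⁺₁ id c id)) ⟩
  length (upTo c)          ≡⟨ length-upTo c ⟩
  c                        ∎
  where open ≡-Reasoning

sum-count-comm : ∀ {R : A → B → Set r} (R? : ∀ x y → Dec (R x y)) xs ys →
                 sum (map (λ x → count (R? x) ys) xs) ≡ sum (map (λ y → count (λ x → R? x y) xs) ys)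
sum-count-comm R? [] [] = refl
sum-count-comm R? [] (y ∷ ys) = sum-count-comm R? [] ys
sum-count-comm R? (x ∷ xs) ys =
  trans (cong (count (R? x) ys +_) (sum-count-comm R? xs ys)) (sym (split ys))
  where
  split : ∀ ys → sum (map (λ y → count (λ x′ → R? x′ y) (x ∷ xs)) ys)
               ≡ count (R? x) ys + sum (map (λ y → count (λ x′ → R? x′ y) xs) ys)
  exchange : ∀ y ys → count (λ x′ → R? x′ y) xs + sum (map (λ y → count (λ x′ → R? x′ y) (x ∷ xs)) ys)
                    ≡ count (R? x) ys + (count (λ x′ → R? x′ y) xs + sum (map (λ y → count (λ x′ → R? x′ y) xs) ys))
  split [] = refl
  split (y ∷ ys) with R? x y
  ... | yes _ = cong suc (exchange y ys)
  ... | no _ = exchange y ys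
  exchange y ys = trans (cong (count (λ x′ → R? x′ y) xs +_) (split ys))
                        (x∙yz≈y∙xz (count (λ x′ → R? x′ y) xs) (count (R? x) ys) _)

sum-map-cong : ∀ {f g : A → ℕ} {xs} → (∀ {x} → x ∈ xs → f x ≡ g x) → sum (map f xs) ≡ sum (map g xs)
sum-map-cong f≡g = cong sum (map-cong-local (All.tabulate f≡g))

sum-map-+ : ∀ (f g : A → ℕ) xs → sum (map (λ x → f x + g x) xs) ≡ sum (map f xs) + sum (map g xs)
sum-map-+ f g [] = refl
sum-map-+ f g (x ∷ xs) = trans (cong (f x + g x +_) (sum-map-+ f g xs)) (interchange (f x) (g x) _ _)

sum-map-≤-injection : ∀ (w : B → ℕ) {f : A → B} {xs ys} → Unique xs →
                      (∀ {x} → x ∈ xs → f x ∈ ys) →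
                      (∀ {x y} → x ∈ xs → y ∈ xs → f x ≡ f y → x ≡ y) →
                      sum (map (w ∘ f) xs) ≤ sum (map w ys)
sum-map-≤-injection w {xs = []} _ _ _ = z≤n
sum-map-≤-injection w {f} {x ∷ xs} (x∉xs ∷ unique) into injective with ∈-∃++ (into (here refl))
... | ys₁ , ys₂ , refl = begin
  w (f x) + sum (map (w ∘ f) xs)       ≤⟨ +-monoʳ-≤ (w (f x)) (sum-map-≤-injection w unique into′ injective′) ⟩
  w (f x) + sum (map w (ys₁ ++ ys₂))   ≡⟨ sum-↭ (map⁺ w (shift (f x) ys₁ ys₂)) ⟨
  sum (map w (ys₁ ++ [ f x ] ++ ys₂))  ∎
  where
  open ≤-Reasoning
  injective′ : ∀ {y z} → y ∈ xs → z ∈ xs → f y ≡ f z → y ≡ z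
  injective′ y∈ z∈ = injective (there y∈) (there z∈)
  into′ : ∀ {y} → y ∈ xs → f y ∈ ys₁ ++ ys₂
  into′ y∈ with ∈-resp-↭ (shift (f x) ys₁ ys₂) (into (there y∈))
  ... | here fy≡fx = contradiction (injective (here refl) (there y∈) (sym fy≡fx)) (All.lookup x∉xs y∈)
  ... | there fy∈ = fy∈

sum-map-≡-by-exchanging-injection :
  ∀ (u v : A → ℕ) {f : A → A} {xs} → Unique xs →
  (∀ {x} → x ∈ xs → f x ∈ xs) → (∀ {x y} → x ∈ xs → y ∈ xs → f x ≡ f y → x ≡ y) →
  (∀ {x} → x ∈ xs → u (f x) ≡ v x) → (∀ {x} → x ∈ xs → v (f x) ≡ u x) →
  sum (map u xs) ≡ sum (map v xs)
sum-map-≡-by-exchanging-injection u v unique into injective uf≡v vf≡u = ≤-antisym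
  (≤-trans (≤-reflexive (sum-map-cong (sym ∘ vf≡u))) (sum-map-≤-injection v unique into injective))
  (≤-trans (≤-reflexive (sum-map-cong (sym ∘ uf≡v))) (sum-map-≤-injection u unique into injective))

module _ {P : Pred A p} {Q : Pred A q} (P? : Decidable P) (Q? : Decidable Q) where

  count-≤-by-leftInverse : ∀ {f g : A → A} {xs} → Unique xs →
                           (∀ {x} → x ∈ xs → P x → f x ∈ xs × Q (f x)) →
                           (∀ {x} → x ∈ xs → P x → g (f x) ≡ x) →
                           count P? xs ≤ count Q? xs
  count-≤-by-leftInverse {f} {g} {xs} unique into gf≡id =
    subst₂ _≤_ (length≡sum-map-1 (filter P? xs)) (length≡sum-map-1 (filter Q? xs))
      (sum-map-≤-injection (λ _ → 1) (Unique.filter⁺ P? unique) into′ injective)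
    where
    length≡sum-map-1 : (ys : List A) → sum (map (λ _ → 1) ys) ≡ length ys
    length≡sum-map-1 [] = refl
    length≡sum-map-1 (_ ∷ ys) = cong suc (length≡sum-map-1 ys)
    into′ : ∀ {x} → x ∈ filter P? xs → f x ∈ filter Q? xs
    into′ x∈ with ∈-filter⁻ P? x∈
    ... | x∈xs , Px = ∈-filter⁺ Q? (proj₁ (into x∈xs Px)) (proj₂ (into x∈xs Px))
    injective : ∀ {x y} → x ∈ filter P? xs → y ∈ filter P? xs → f x ≡ f y → x ≡ y
    injective x∈ y∈ fx≡fy with ∈-filter⁻ P? x∈ | ∈-filter⁻ P? y∈
    ... | x∈xs , Px | y∈xs , Py =
      trans (sym (gf≡id x∈xs Px)) (trans (cong g fx≡fy) (gf≡id y∈xs Py))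

-- Partitions and conjugation

∈⇒≤largest : ∀ {k π} → Linked _≥_ π → k ∈ π → k ≤ largest π
∈⇒≤largest _ (here refl) = ≤-refl
∈⇒≤largest (a≥b ∷ desc) (there k∈) = ≤-trans (∈⇒≤largest desc k∈) a≥b

largest-tail≤head : ∀ {a π} → Linked _≥_ (a ∷ π) → largest π ≤ a
largest-tail≤head [-] = z≤n
largest-tail≤head (a≥b ∷ _) = a≥b

largest≤sum : ∀ π → largest π ≤ sum π
largest≤sum [] = z≤n
largest≤sum (a ∷ π) = m≤m+n a (sum π)

length≤sum : ∀ {π} → All (1 ≤_) π → length π ≤ sum π
length≤sum [] = z≤n
length≤sum (1≤a ∷ pos) = +-mono-≤ 1≤a (length≤sum pos)

sum-map-suc : ∀ xs → sum (map suc xs) ≡ length xs + sum xs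
sum-map-suc [] = refl
sum-map-suc (x ∷ xs) = cong suc (trans (cong (x +_) (sum-map-suc xs)) (x∙yz≈y∙xz x (length xs) (sum xs)))

sum-replicate : ∀ k x → sum (replicate k x) ≡ k * x
sum-replicate zero x = refl
sum-replicate (suc k) x = cong (x +_) (sum-replicate k x)

replicate-descending : ∀ k x → Linked _≥_ (replicate k x)
replicate-descending zero x = []
replicate-descending (suc zero) x = [-]
replicate-descending (suc (suc k)) x = ≤-refl ∷ replicate-descending (suc k) x

descending-↭⇒≡ : ∀ {xs ys} → Linked _≥_ xs → Linked _≥_ ys → xs ↭ ys → xs ≡ ys
descending-↭⇒≡ xs↘ ys↘ xs↭ys = Pointwise-≡⇒≡ (↗↭↗⇒≋ ≥-totalOrder xs↘ ys↘ (↭⇒↭ₛ xs↭ys))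

-- Putting a first row of length a on top of π lengthens each of its largest π
-- columns by one and adds a ∸ largest π columns of height 1.
conjugate : List ℕ → List ℕ
conjugate [] = []
conjugate (a ∷ π) = map suc (conjugate π) ++ replicate (a ∸ largest π) 1

removeFirstColumn : List ℕ → List ℕ
removeFirstColumn [] = []
removeFirstColumn (suc (suc a) ∷ π) = suc a ∷ removeFirstColumn π
removeFirstColumn (_ ∷ π) = removeFirstColumn π

removeFirstColumn-addColumn : ∀ {c} k → All (1 ≤_) c → removeFirstColumn (map suc c ++ replicate k 1) ≡ c
removeFirstColumn-addColumn zero [] = refl
removeFirstColumn-addColumn (suc k) [] = removeFirstColumn-addColumn k []
removeFirstColumn-addColumn {suc a ∷ c} k (_ ∷ pos) = cong (suc a ∷_) (removeFirstColumn-addColumn k pos)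

length-conjugate : ∀ {π} → Linked _≥_ π → length (conjugate π) ≡ largest π
length-conjugate {[]} _ = refl
length-conjugate {a ∷ π} desc = begin
  length (map suc (conjugate π) ++ replicate (a ∸ largest π) 1)  ≡⟨ length-++ (map suc (conjugate π)) ⟩
  length (map suc (conjugate π)) + length (replicate (a ∸ largest π) 1)
                                             ≡⟨ cong₂ _+_ (length-map suc (conjugate π)) (length-replicate (a ∸ largest π)) ⟩
  length (conjugate π) + (a ∸ largest π)     ≡⟨ cong (_+ (a ∸ largest π)) (length-conjugate (Linked.tail desc)) ⟩
  largest π + (a ∸ largest π)                ≡⟨ m+[n∸m]≡n (largest-tail≤head desc) ⟩
  a                                          ∎
  where open ≡-Reasoning

sum-conjugate : ∀ {π} → Linked _≥_ π → sum (conjugate π) ≡ sum π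
sum-conjugate {[]} _ = refl
sum-conjugate {a ∷ π} desc = begin
  sum (map suc (conjugate π) ++ replicate (a ∸ largest π) 1)
    ≡⟨ sum-++ (map suc (conjugate π)) _ ⟩
  sum (map suc (conjugate π)) + sum (replicate (a ∸ largest π) 1)
    ≡⟨ cong₂ _+_ (sum-map-suc (conjugate π)) (trans (sum-replicate (a ∸ largest π) 1) (*-identityʳ _)) ⟩
  length (conjugate π) + sum (conjugate π) + (a ∸ largest π)
    ≡⟨ cong₂ (λ l s → l + s + (a ∸ largest π)) (length-conjugate desc′) (sum-conjugate desc′) ⟩
  largest π + sum π + (a ∸ largest π)
    ≡⟨ cong (_+ (a ∸ largest π)) (+-comm (largest π) (sum π)) ⟩
  sum π + largest π + (a ∸ largest π)
    ≡⟨ +-assoc (sum π) _ _ ⟩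
  sum π + (largest π + (a ∸ largest π))
    ≡⟨ cong (sum π +_) (m+[n∸m]≡n (largest-tail≤head desc)) ⟩
  sum π + a
    ≡⟨ +-comm (sum π) a ⟩
  a + sum π ∎
  where
  open ≡-Reasoning
  desc′ : Linked _≥_ π
  desc′ = Linked.tail desc

largest-conjugate : ∀ {π} → All (1 ≤_) π → largest (conjugate π) ≡ length π
largest-conjugate [] = refl
largest-conjugate {suc a ∷ []} _ = refl
largest-conjugate {a ∷ b ∷ π} (_ ∷ pos) with conjugate (b ∷ π) | largest-conjugate pos
... | c ∷ _ | c≡length = cong suc c≡length

conjugate-positive : ∀ π → All (1 ≤_) (conjugate π)
conjugate-positive [] = []
conjugate-positive (a ∷ π) =
  All.++⁺ (All.map⁺ (All.tabulate (λ _ → s≤s z≤n))) (All.replicate⁺ (a ∸ largest π) ≤-refl)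

conjugate-descending : ∀ π → Linked _≥_ (conjugate π)
conjugate-descending [] = []
conjugate-descending (a ∷ π) = addColumn (a ∸ largest π) (conjugate-descending π)
  where
  addColumn : ∀ {c} k → Linked _≥_ c → Linked _≥_ (map suc c ++ replicate k 1)
  addColumn k [] = replicate-descending k 1
  addColumn zero [-] = [-]
  addColumn (suc k) [-] = s≤s z≤n ∷ replicate-descending (suc k) 1
  addColumn k (x≥y ∷ desc) = s≤s x≥y ∷ addColumn k desc

conjugate-isPartition : ∀ {n π} → IsPartition n π → IsPartition n (conjugate π)
conjugate-isPartition {π = π} (_ , desc , sum≡n) =
  conjugate-positive π , conjugate-descending π , trans (sum-conjugate desc) sum≡n

conjugate-injective : ∀ {π π′} → Linked _≥_ π → Linked _≥_ π′ → All (1 ≤_) π → All (1 ≤_) π′ →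
                      conjugate π ≡ conjugate π′ → π ≡ π′
conjugate-injective {[]} {[]} _ _ _ _ _ = refl
conjugate-injective {[]} {b ∷ π′} desc desc′ _ (1≤b ∷ _) eq =
  contradiction (trans (cong length eq) (length-conjugate desc′)) (<⇒≢ 1≤b)
conjugate-injective {a ∷ π} {[]} desc desc′ (1≤a ∷ _) _ eq =
  contradiction (trans (sym (cong length eq)) (length-conjugate desc)) (<⇒≢ 1≤a)
conjugate-injective {a ∷ π} {b ∷ π′} desc desc′ (_ ∷ pos) (_ ∷ pos′) eq =
  cong₂ _∷_ a≡b (conjugate-injective (Linked.tail desc) (Linked.tail desc′) pos pos′ tails≡)
  where
  a≡b : a ≡ b
  a≡b = trans (sym (length-conjugate desc)) (trans (cong length eq) (length-conjugate desc′))
  tails≡ : conjugate π ≡ conjugate π′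
  tails≡ = trans (sym (removeFirstColumn-addColumn _ (conjugate-positive π)))
                 (trans (cong removeFirstColumn eq) (removeFirstColumn-addColumn _ (conjugate-positive π′)))

-- Trading a part k for k parts equal to 1

++-cancelˡ-↭ : ∀ (xs : List A) {ys zs} → xs ++ ys ↭ xs ++ zs → ys ↭ zs
++-cancelˡ-↭ [] ys↭zs = ys↭zs
++-cancelˡ-↭ (x ∷ xs) p = ++-cancelˡ-↭ xs (drop-∷ p)

delete : ℕ → List ℕ → List ℕ
delete x [] = []
delete x (y ∷ ys) with x ≟ y
... | yes _ = ys
... | no _ = y ∷ delete x ys

delete-↭ : ∀ {x xs} → x ∈ xs → xs ↭ x ∷ delete x xs
delete-↭ {x} {y ∷ ys} x∈ with x ≟ y
... | yes refl = ↭-refl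
delete-↭ (here x≡y) | no x≢y = contradiction x≡y x≢y
delete-↭ {x} {y ∷ ys} (there x∈) | no _ = ↭-trans (↭-prep y (delete-↭ x∈)) (↭-swap y x ↭-refl)

ones : List ℕ → ℕ
ones = count (_≟ 1)

ones-replicate-++ : ∀ k σ → ones (replicate k 1 ++ σ) ≡ k + ones σ
ones-replicate-++ zero σ = refl
ones-replicate-++ (suc k) σ = cong suc (ones-replicate-++ k σ)

sum-replicate-++ : ∀ k σ → sum (replicate k 1 ++ σ) ≡ k + sum σ
sum-replicate-++ zero σ = refl
sum-replicate-++ (suc k) σ = cong suc (sum-replicate-++ k σ)

deleteOnes : ℕ → List ℕ → List ℕ
deleteOnes zero π = π
deleteOnes (suc j) π = deleteOnes j (delete 1 π)

deleteOnes-↭ : ∀ {j π} → j ≤ ones π → π ↭ replicate j 1 ++ deleteOnes j π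
deleteOnes-↭ {zero} _ = ↭-refl
deleteOnes-↭ {suc j} {π} j<ones = ↭-trans π↭ (↭-prep 1 (deleteOnes-↭ j≤ones))
  where
  π↭ : π ↭ 1 ∷ delete 1 π
  π↭ = delete-↭ (Any.map sym (0<count⇒Any (_≟ 1) π (≤-trans (s≤s z≤n) j<ones)))
  j≤ones : j ≤ ones (delete 1 π)
  j≤ones = s≤s⁻¹ (subst (suc j ≤_) (count-↭ (_≟ 1) π↭) j<ones)

-- Both maps sort their result. A descending list is determined by its multiset of
-- parts (descending-↭⇒≡), so the inverse laws reduce to permutation bookkeeping.
splitPart : ℕ → List ℕ → List ℕ
splitPart k π = sort (replicate k 1 ++ delete k π)

mergeOnes : ℕ → List ℕ → List ℕ
mergeOnes k π = sort (k ∷ deleteOnes k π)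

splitPart-isPartition : ∀ {k n π} → k ∈ π → IsPartition n π → IsPartition n (splitPart k π)
splitPart-isPartition {k} {n} {π} k∈π (pos , _ , sum≡n) =
  All-resp-↭ (↭-sym (sort-↭ _)) (All.++⁺ (All.replicate⁺ k ≤-refl) (All.tail (All-resp-↭ π↭ pos))) ,
  sort-↗ _ ,
  (begin
    sum (splitPart k π)               ≡⟨ sum-↭ (sort-↭ _) ⟩
    sum (replicate k 1 ++ delete k π) ≡⟨ sum-replicate-++ k (delete k π) ⟩
    k + sum (delete k π)              ≡⟨ sum-↭ π↭ ⟨
    sum π                             ≡⟨ sum≡n ⟩
    n                                 ∎)
  where
  open ≡-Reasoning
  π↭ : π ↭ k ∷ delete k π
  π↭ = delete-↭ k∈π

k≤ones-splitPart : ∀ k π → k ≤ ones (splitPart k π)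
k≤ones-splitPart k π = ≤-trans (m≤m+n k _)
  (≤-reflexive (sym (trans (count-↭ (_≟ 1) (sort-↭ _)) (ones-replicate-++ k (delete k π)))))

mergeOnes-isPartition : ∀ {k n π} → 1 ≤ k → k ≤ ones π → IsPartition n π → IsPartition n (mergeOnes k π)
mergeOnes-isPartition {k} {n} {π} 1≤k k≤ones (pos , _ , sum≡n) =
  All-resp-↭ (↭-sym (sort-↭ _)) (1≤k ∷ All.++⁻ʳ (replicate k 1) (All-resp-↭ π↭ pos)) ,
  sort-↗ _ ,
  (begin
    sum (mergeOnes k π)                      ≡⟨ sum-↭ (sort-↭ _) ⟩
    k + sum (deleteOnes k π)                 ≡⟨ sum-replicate-++ k (deleteOnes k π) ⟨
    sum (replicate k 1 ++ deleteOnes k π)    ≡⟨ sum-↭ π↭ ⟨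
    sum π                                    ≡⟨ sum≡n ⟩
    n                                        ∎)
  where
  open ≡-Reasoning
  π↭ : π ↭ replicate k 1 ++ deleteOnes k π
  π↭ = deleteOnes-↭ k≤ones

∈-mergeOnes : ∀ k π → k ∈ mergeOnes k π
∈-mergeOnes k π = ∈-resp-↭ (↭-sym (sort-↭ _)) (here refl)

mergeOnes-splitPart : ∀ {k π} → k ∈ π → Linked _≥_ π → mergeOnes k (splitPart k π) ≡ π
mergeOnes-splitPart {k} {π} k∈π desc = descending-↭⇒≡ (sort-↗ _) desc (begin
  mergeOnes k ρ       ↭⟨ sort-↭ _ ⟩
  k ∷ deleteOnes k ρ  ↭⟨ ↭-prep k (++-cancelˡ-↭ (replicate k 1) ones++rest) ⟩
  k ∷ delete k π      ↭⟨ delete-↭ k∈π ⟨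
  π                   ∎)
  where
  open PermutationReasoning
  ρ : List ℕ
  ρ = splitPart k π
  ones++rest : replicate k 1 ++ deleteOnes k ρ ↭ replicate k 1 ++ delete k π
  ones++rest = ↭-trans (↭-sym (deleteOnes-↭ (k≤ones-splitPart k π))) (sort-↭ _)

splitPart-mergeOnes : ∀ {k π} → k ≤ ones π → Linked _≥_ π → splitPart k (mergeOnes k π) ≡ π
splitPart-mergeOnes {k} {π} k≤ones desc = descending-↭⇒≡ (sort-↗ _) desc (begin
  splitPart k ρ                    ↭⟨ sort-↭ _ ⟩
  replicate k 1 ++ delete k ρ      ↭⟨ ++⁺ˡ (replicate k 1) (drop-∷ k∷rest) ⟩
  replicate k 1 ++ deleteOnes k π  ↭⟨ deleteOnes-↭ k≤ones ⟨
  π                                ∎)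
  where
  open PermutationReasoning
  ρ : List ℕ
  ρ = mergeOnes k π
  k∷rest : k ∷ delete k ρ ↭ k ∷ deleteOnes k π
  k∷rest = ↭-trans (↭-sym (delete-↭ (∈-mergeOnes k π))) (sort-↭ _)

-- Missing integers and distinct parts

-- The number of distinct parts of π when all of them are at most n.
distinctParts : ℕ → List ℕ → ℕ
distinctParts n π = count (λ k → suc k ∈? π) (upTo n)

numMissing+distinctParts≡largest : ∀ {n π} → IsPartition n π → numMissing π + distinctParts n π ≡ largest π
numMissing+distinctParts≡largest {n} {[]} _ = count-upTo-beyond (λ k → suc k ∈? []) {n = n} z≤n (λ _ ())
numMissing+distinctParts≡largest {π = zero ∷ _} (() ∷ _ , _)
numMissing+distinctParts≡largest {n} {π@(suc m ∷ _)} (_ , desc , sum≡n) = begin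
  numMissing π + distinctParts n π                   ≡⟨ cong₂ _+_ missing≡ distinct≡ ⟩
  count (∁? P?) (upTo m) + suc (count P? (upTo m))   ≡⟨ +-suc _ _ ⟩
  suc (count (∁? P?) (upTo m) + count P? (upTo m))   ≡⟨ cong suc (count-∁ P? (upTo m)) ⟩
  suc (length (upTo m))                              ≡⟨ cong suc (length-upTo m) ⟩
  suc m                                              ∎
  where
  open ≡-Reasoning
  P? : Decidable (λ k → suc k ∈ π)
  P? k = suc k ∈? π
  missing≡ : numMissing π ≡ count (∁? P?) (upTo m)
  missing≡ = trans (cong (count (∁? (_∈? π)))
                         (trans (filter-all (1 ≤?_) (applyUpTo⁺₂ suc m (λ _ → s≤s z≤n))) (sym (map-upTo suc m))))
                   (count-map (∁? (_∈? π)) suc (upTo m))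
  beyond : ∀ {k} → suc m ≤ k → ¬ suc k ∈ π
  beyond sm≤k sk∈π = 1+n≰n (≤-trans (∈⇒≤largest desc sk∈π) sm≤k)
  distinct≡ : distinctParts n π ≡ suc (count P? (upTo m))
  distinct≡ = trans (count-upTo-beyond P? (subst (suc m ≤_) sum≡n (largest≤sum π)) beyond)
                    (count-upTo-suc-accept P? (here refl))

ones≤n : ∀ {n π} → IsPartition n π → ones π ≤ n
ones≤n {π = π} (pos , _ , sum≡n) = ≤-trans (length-filter (_≟ 1) π) (subst (length π ≤_) sum≡n (length≤sum pos))

-- Sums over the partitions of n

module _ {n : ℕ} {ps : List (List ℕ)} (unique : Unique ps)
         (enumerates : ∀ π → (π ∈ ps) ⇔ IsPartition n π) where

  private
    partition : ∀ {π} → π ∈ ps → IsPartition n π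
    partition {π} = Equivalence.to (enumerates π)

    enumerated : ∀ {π} → IsPartition n π → π ∈ ps
    enumerated {π} = Equivalence.from (enumerates π)

    descending : ∀ {π} → π ∈ ps → Linked _≥_ π
    descending = proj₁ ∘ proj₂ ∘ partition

  sum-length≡sum-largest : sum (map length ps) ≡ sum (map largest ps)
  sum-length≡sum-largest = sum-map-≡-by-exchanging-injection length largest unique
    (enumerated ∘ conjugate-isPartition ∘ partition)
    (λ π∈ π′∈ → conjugate-injective (descending π∈) (descending π′∈) (proj₁ (partition π∈)) (proj₁ (partition π′∈)))
    (length-conjugate ∘ descending)
    (largest-conjugate ∘ proj₁ ∘ partition)

  count-∋≡count-ones≥ : ∀ {k} → 1 ≤ k → count (k ∈?_) ps ≡ count (λ π → k ≤? ones π) ps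
  count-∋≡count-ones≥ {k} 1≤k = ≤-antisym
    (count-≤-by-leftInverse (k ∈?_) (λ π → k ≤? ones π) {splitPart k} {mergeOnes k} unique
      (λ {π} π∈ k∈π → enumerated (splitPart-isPartition k∈π (partition π∈)) , k≤ones-splitPart k π)
      (λ π∈ k∈π → mergeOnes-splitPart k∈π (descending π∈)))
    (count-≤-by-leftInverse (λ π → k ≤? ones π) (k ∈?_) {mergeOnes k} {splitPart k} unique
      (λ π∈ k≤ones → enumerated (mergeOnes-isPartition 1≤k k≤ones (partition π∈)) , ∈-mergeOnes k _)
      (λ π∈ k≤ones → splitPart-mergeOnes k≤ones (descending π∈)))

  sum-distinctParts≡sum-ones : sum (map (distinctParts n) ps) ≡ sum (map ones ps)
  sum-distinctParts≡sum-ones = begin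
    sum (map (λ π → count (λ k → suc k ∈? π) (upTo n)) ps)   ≡⟨ sum-count-comm (λ π k → suc k ∈? π) ps (upTo n) ⟩
    sum (map (λ k → count (λ π → suc k ∈? π) ps) (upTo n))   ≡⟨ cong sum (map-cong (λ _ → count-∋≡count-ones≥ (s≤s z≤n)) (upTo n)) ⟩
    sum (map (λ k → count (λ π → k <? ones π) ps) (upTo n))  ≡⟨ sum-count-comm (λ π k → k <? ones π) ps (upTo n) ⟨
    sum (map (λ π → count (λ k → k <? ones π) (upTo n)) ps)  ≡⟨ sum-map-cong (count-<-upTo ∘ ones≤n ∘ partition) ⟩
    sum (map ones ps)                                         ∎
    where open ≡-Reasoning

corollary2p10 : (n : ℕ) (ps : List (List ℕ)) →
    Unique ps → (∀ π → (π ∈ ps) ⇔ IsPartition n π) →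
    sum (map numMissing ps) ≡ sum (map numNonOneParts ps)
corollary2p10 n ps unique enumerates = +-cancelʳ-≡ (Σ (distinctParts n)) (Σ numMissing) (Σ numNonOneParts) (begin
  Σ numMissing + Σ (distinctParts n)          ≡⟨ sum-map-+ numMissing (distinctParts n) ps ⟨
  Σ (λ π → numMissing π + distinctParts n π)  ≡⟨ sum-map-cong (numMissing+distinctParts≡largest ∘ partition) ⟩
  Σ largest                                   ≡⟨ sum-length≡sum-largest unique enumerates ⟨
  Σ length                                    ≡⟨ cong sum (map-cong (count-∁ (_≟ 1)) ps) ⟨
  Σ (λ π → numNonOneParts π + ones π)         ≡⟨ sum-map-+ numNonOneParts ones ps ⟩
  Σ numNonOneParts + Σ ones                   ≡⟨ cong (Σ numNonOneParts +_) (sum-distinctParts≡sum-ones unique enumerates) ⟨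
  Σ numNonOneParts + Σ (distinctParts n)      ∎)
  where
  open ≡-Reasoning
  Σ : (List ℕ → ℕ) → ℕ
  Σ f = sum (map f ps)
  partition : ∀ {π} → π ∈ ps → IsPartition n π
  partition {π} = Equivalence.to (enumerates π)
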